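{- Let $k\in\mathbb{Z}$, $c\in\mathbb{A}_k$, $x\in\mathsf{Set}_k$ and $y\in\mathsf{Set}_{k-1}$ with $c\#y$. If $z=\mathsf{st}([c](y\mathbin{\tilde\in}c))\in\mathsf{Set}_{k+1}$, then $x\mathbin{\tilde\in}z=y\mathbin{\tilde\in}x$.
   Context: Atoms: for each $i\in\mathbb{Z}$ fix a countably infinite set $\mathbb{A}_i$ of atoms, pairwise disjoint, $\mathbb{A}=\bigcup_i\mathbb{A}_i$, $\mathrm{level}(a)=i$ iff $a\in\mathbb{A}_i$. Permutations are finitely-supported level-preserving bijections of $\mathbb{A}$; $\mathrm{supp}(x)$ is the least finite set of atoms such that every permutation fixing it pointwise fixes $x$, and $a\#x$ means $a\notin\mathrm{supp}(x)$. $[a]X$ is nominal atoms-abstraction (binding $a$ in $X$): $[a]X=[b]((b\ a)\cdot X)$ when $b\#X$. Internal syntax: $\mathsf{Pred}$ and $\mathsf{Set}_i$ ($i\in\mathbb{Z}$) are defined inductively: $\mathsf{atm}(a)\in\mathsf{Set}_i$ for $a\in\mathbb{A}_i$; $\mathsf{and}(\mathcal X)\in\mathsf{Pred}$ for finite $\mathcal X\subseteq\mathsf{Pred}$; $\mathsf{neg}(X)$; $\mathsf{all}([a]X)$ for $a\in\mathbb{A}$; $\mathsf{elt}(x,a)\in\mathsf{Pred}$ for $a\in\mathbb{A}_{i+1}$, $x\in\mathsf{Set}_i$; $\mathsf{st}([a]X)\in\mathsf{Set}_i$ for $a\in\mathbb{A}_{i-1}$, $X\in\mathsf{Pred}$ (an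 internal comprehension). For an internal comprehension $x\in\mathsf{Set}_{i}$ and $c\in\mathbb{A}_{i-1}$ with $c\#x$, $x@c$ is the unique $X$ with $x=\mathsf{st}([c]X)$. Sigma-action: for $a\in\mathbb{A}_i$, $x\in\mathsf{Set}_i$, the well-defined operation $Z[a\mapsto x]$, $z[a\mapsto x]$ is given by (with $b,c$ atoms distinct from $a$): $\mathsf{and}(\mathcal X)[a\mapsto x]=\mathsf{and}(\{X[a\mapsto x]\mid X\in\mathcal X\})$; $\mathsf{neg}(X)[a\mapsto x]=\mathsf{neg}(X[a\mapsto x])$; $\mathsf{all}([b]X)[a\mapsto x]=\mathsf{all}([b](X[a\mapsto x]))$ if $b\#x$; $\mathsf{elt}(y,a)[a\mapsto\mathsf{atm}(n)]=\mathsf{elt}(y[a\mapsto\mathsf{atm}(n)],n)$ for any $n\in\mathbb{A}_i$; $\mathsf{elt}(y,a)[a\mapsto\mathsf{st}([a']X')]=X'[a'\mapsto y[a\mapsto\mathsf{st}([a']X')]]$ for fresh $a'\in\mathbb{A}_{i-1}$; $\mathsf{elt}(y,b)[a\mapsto x]=\mathsf{elt}(y[a\mapsto x],b)$; $\mathsf{atm}(a)[a\mapsto x]=x$; $\mathsf{atm}(b)[a\mapsto x]=\mathsf{atm}(b)$; $\mathsf{st}([c]X)[a\mapsto x]=\mathsf{st}([c](X[a\mapsto x]))$ if $c\#x$. Internal membership: for $x\in\mathsf{Set}_{i}$ and $y\in\mathsf{Set}_{i-1}$, $y\mathbin{\tilde\in}x=(x@b)[b\mapsto y]$ for a fresh $b\in\mathbb{A}_{i-1}$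 (with $b\#x,y$) if $x$ is an internal comprehension, and $y\mathbin{\tilde\in}\mathsf{atm}(a)=\mathsf{elt}(y,a)$; for an atom $c\in\mathbb{A}_i$ also $y\mathbin{\tilde\in}c=\mathsf{elt}(y,c)$. -}

module Defs where

open import Data.Integer using (ℤ; _+_; _-_; 1ℤ)
import Data.Integer.Properties as ℤP
open import Data.Nat using (ℕ)
import Data.Nat.Properties as ℕP
open import Data.List using (List; []; _∷_; filter; _++_; map; concatMap)
open import Data.List.Relation.Unary.All using (All)
open import Data.List.Relation.Unary.Any using (Any)
open import Data.List.Relation.Binary.Pointwise using (Pointwise)
open import Data.List.Membership.Propositional using (_∈_; _∉_)
open import Data.Product using (Σ; _×_; _,_; ∃)
open import Relation.Binary.PropositionalEquality using (_≡_; _≢_; refl; cong₂)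
open import Relation.Nullary using (Dec; yes; no; ¬_; ¬?)
open import Relation.Nullary.Decidable using (map′)

-- Atoms: an atom is a pair (level, name); A_i = { atoms of level i },
-- countably infinite for each i ∈ ℤ and pairwise disjoint.

record Atom : Set where
  constructor mkAtom
  field
    level : ℤ
    name  : ℕ
open Atom public

_≟A_ : (a b : Atom) → Dec (a ≡ b)
mkAtom i m ≟A mkAtom j n with i ℤP.≟ j | m ℕP.≟ n
... | yes refl | yes refl = yes refl
... | no i≢j   | _        = no λ { refl → i≢j refl }
... | yes _    | no m≢n   = no λ { refl → m≢n refl }

-- Raw internal syntax (Pred and Set_i share one carrier; the sorts are
-- carved out by the predicates IsPred / IsSet below).
--   atm a      : atm(a)
--   and Xs     : and(𝒳), the finite set 𝒳 given by a list (equality of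
--                and-terms is set-extensional, see _≈_)
--   neg X      : neg(X)
--   all a X    : all([a]X)
--   elt x a    : elt(x,a)
--   st a X     : st([a]X)

data Tm : Set where
  atm : Atom → Tm
  and : List Tm → Tm
  neg : Tm → Tm
  all : Atom → Tm → Tm
  elt : Tm → Atom → Tm
  st  : Atom → Tm → Tm

mutual
  data IsPred : Tm → Set where
    and-p : ∀ {Xs} → All IsPred Xs → IsPred (and Xs)
    neg-p : ∀ {X} → IsPred X → IsPred (neg X)
    all-p : ∀ {a X} → IsPred X → IsPred (all a X)
    elt-p : ∀ {i x a} → level a ≡ i + 1ℤ → IsSet i x → IsPred (elt x a)

  data IsSet : ℤ → Tm → Set where
    atm-s : ∀ {i a} → level a ≡ i → IsSet i (atm a)
    st-s  : ∀ {i a X} → level a ≡ i - 1ℤ → IsPred X → IsSet i (st a X)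

-- Free atoms (= nominal support of the α-equivalence class) and freshness.

remove : Atom → List Atom → List Atom
remove a = filter (λ b → ¬? (b ≟A a))

mutual
  fa : Tm → List Atom
  fa (atm a)   = a ∷ []
  fa (and Xs)  = faL Xs
  fa (neg X)   = fa X
  fa (all a X) = remove a (fa X)
  fa (elt x a) = a ∷ fa x
  fa (st a X)  = remove a (fa X)

  faL : List Tm → List Atom
  faL []       = []
  faL (X ∷ Xs) = fa X ++ faL Xs

_#_ : Atom → Tm → Set
a # t = a ∉ fa t

swapA : Atom → Atom → Atom → Atom
swapA a b c with c ≟A a | c ≟A b
... | yes _ | _     = b
... | no _  | yes _ = a
... | no _  | no _  = c

mutual
  swap : Atom → Atom → Tm → Tm
  swap a b (atm c)   = atm (swapA a b c)
  swap a b (and Xs)  = and (swapL a b Xs)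
  swap a b (neg X)   = neg (swap a b X)
  swap a b (all c X) = all (swapA a b c) (swap a b X)
  swap a b (elt x c) = elt (swap a b x) (swapA a b c)
  swap a b (st c X)  = st (swapA a b c) (swap a b X)

  swapL : Atom → Atom → List Tm → List Tm
  swapL a b []       = []
  swapL a b (X ∷ Xs) = swap a b X ∷ swapL a b Xs

-- Equality of the internal syntax: α-equivalence of the nominal
-- abstractions [a]X, together with set-extensional equality of the
-- finite sets 𝒳 in and(𝒳).
-- [a]X = [b]Y  iff  for some c of the same level with c # X, c # Y,
-- (c a)·X = (c b)·Y.

infix 4 _≈_
data _≈_ : Tm → Tm → Set where
  atm≈ : ∀ {a} → atm a ≈ atm a
  and≈ : ∀ {Xs Ys} →
         All (λ X → Any (λ Y → X ≈ Y) Ys) Xs →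
         All (λ Y → Any (λ X → X ≈ Y) Xs) Ys →
         and Xs ≈ and Ys
  neg≈ : ∀ {X Y} → X ≈ Y → neg X ≈ neg Y
  all≈ : ∀ {a b X Y} (c : Atom) →
         level a ≡ level b → level c ≡ level a → c # X → c # Y →
         swap c a X ≈ swap c b Y → all a X ≈ all b Y
  elt≈ : ∀ {x y a} → x ≈ y → elt x a ≈ elt y a
  st≈  : ∀ {a b X Y} (c : Atom) →
         level a ≡ level b → level c ≡ level a → c # X → c # Y →
         swap c a X ≈ swap c b Y → st a X ≈ st b Y

-- The sigma-action Z[a ↦ x], given as its graph:
--   Sub a x Z R   means   Z[a ↦ x] = R.
-- Each constructor is one defining clause from the paper; sub-≈ says
-- the action is an operation on α-equivalence classes (and on finite
-- sets for and(-)).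

data Sub (a : Atom) : Tm → Tm → Tm → Set where
  sub-≈    : ∀ {x x' Z Z' R R'} → x ≈ x' → Z ≈ Z' → R' ≈ R →
             Sub a x' Z' R' → Sub a x Z R
  sub-and  : ∀ {x Xs Rs} → Pointwise (Sub a x) Xs Rs →
             Sub a x (and Xs) (and Rs)
  sub-neg  : ∀ {x X R} → Sub a x X R → Sub a x (neg X) (neg R)
  sub-all  : ∀ {x b X R} → b ≢ a → b # x → Sub a x X R →
             Sub a x (all b X) (all b R)
  sub-elt-atm : ∀ {y y' n} → Sub a (atm n) y y' →
             Sub a (atm n) (elt y a) (elt y' n)
  sub-elt-st  : ∀ {y y' a' X' R} → a' ≢ a → a' # y →
             Sub a (st a' X') y y' → Sub a' y' X' R →
             Sub a (st a' X') (elt y a) R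
  sub-elt  : ∀ {x y y' b} → b ≢ a → Sub a x y y' →
             Sub a x (elt y b) (elt y' b)
  sub-atm-same : ∀ {x} → Sub a x (atm a) x
  sub-atm-other : ∀ {x b} → b ≢ a → Sub a x (atm b) (atm b)
  sub-st   : ∀ {x c X R} → c ≢ a → c # x → Sub a x X R →
             Sub a x (st c X) (st c R)

-- Internal membership, as a graph:  Mem y x R  means  y ∈̃ x = R.
--   x an internal comprehension: y ∈̃ x = (x@b)[b ↦ y] for fresh b,
--     where x = st([b](x@b));
--   y ∈̃ atm(a) = elt(y,a).
-- (For an atom c, y ∈̃ c = elt(y,c) is used directly in the statement.)

data Mem (y : Tm) : Tm → Tm → Set where
  mem-st  : ∀ {x b X R} → x ≈ st b X → b # x → b # y →
            Sub b y X R → Mem y x R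
  mem-atm : ∀ {a R} → elt y a ≈ R → Mem y (atm a) R

module Submission where

-- Both sides are computed through a fresh atom b.  Unfolding membership,
-- x ∈̃ z is elt(y,b)[b ↦ x] (after α-renaming z to st([b] elt(y,b))), and the
-- defining clauses of the sigma-action for elt(y,b)[b ↦ x] are exactly the
-- two clauses of y ∈̃ x: for x = atm(n) one gets elt(y,n), and for
-- x = st([a']X') one gets X'[a' ↦ y]; in both cases y is left unchanged by
-- substituting for b, because b # y.

open import Defs
open import Data.Integer using (ℤ; _+_; _-_; 1ℤ)
open import Data.Nat using (ℕ; suc; _⊔_; _≤_)
import Data.Nat.Properties as ℕP
open import Data.List using (List; []; _∷_; _++_)
open import Data.List.Relation.Unary.All using (All; []; _∷_)
import Data.List.Relation.Unary.All as All
open import Data.List.Relation.Unary.Any using (Any; here; there)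
import Data.List.Relation.Unary.Any as Any
open import Data.List.Relation.Binary.Pointwise using (Pointwise; []; _∷_)
open import Data.List.Membership.Propositional using (_∈_; _∉_)
open import Data.List.Membership.Propositional.Properties
  using (∈-++⁺ˡ; ∈-++⁺ʳ; ∈-++⁻; ∈-filter⁺; ∈-filter⁻)
open import Data.Product using (Σ; _×_; _,_; ∃; proj₂)
open import Data.Sum using (inj₁; inj₂)
open import Data.Empty using (⊥-elim)
open import Relation.Binary.PropositionalEquality
  using (_≡_; _≢_; refl; cong₂; cong; sym; trans; subst; subst₂)
open import Relation.Nullary using (Dec; yes; no; ¬?)
open import Function using (_∘_; id)
open import Function.Bundles using (_⇔_; mk⇔)

∈-remove⁺ : ∀ {a v L} → v ∈ L → v ≢ a → v ∈ remove a L
∈-remove⁺ {a} = ∈-filter⁺ (λ b → ¬? (b ≟A a))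

∈-remove⁻ : ∀ {a v L} → v ∈ remove a L → v ∈ L × v ≢ a
∈-remove⁻ {a} = ∈-filter⁻ (λ b → ¬? (b ≟A a))

∉-remove : ∀ a L → a ∉ remove a L
∉-remove a L p = proj₂ (∈-remove⁻ {a} {a} {L} p) refl

maxName : List Atom → ℕ
maxName []      = 0
maxName (a ∷ L) = name a ⊔ maxName L

maxName-≤ : ∀ {a L} → a ∈ L → name a ≤ maxName L
maxName-≤ {L = b ∷ L} (here refl) = ℕP.m≤m⊔n (name b) (maxName L)
maxName-≤ {L = b ∷ L} (there p)   =
  ℕP.≤-trans (maxName-≤ p) (ℕP.m≤n⊔m (name b) (maxName L))

fresh : ℤ → List Atom → Atom
fresh i L = mkAtom i (suc (maxName L))

fresh-∉ : ∀ i L → fresh i L ∉ L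
fresh-∉ i L p = ℕP.<-irrefl refl (maxName-≤ p)

swapA-left : ∀ a b → swapA a b a ≡ b
swapA-left a b with a ≟A a
... | yes _ = refl
... | no a≢a = ⊥-elim (a≢a refl)

swapA-right : ∀ a b → swapA a b b ≡ a
swapA-right a b with b ≟A a | b ≟A b
... | yes refl | _     = refl
... | no _     | yes _ = refl
... | no _     | no b≢b = ⊥-elim (b≢b refl)

swapA-other : ∀ a b c → c ≢ a → c ≢ b → swapA a b c ≡ c
swapA-other a b c c≢a c≢b with c ≟A a | c ≟A b
... | yes c≡a | _       = ⊥-elim (c≢a c≡a)
... | no _    | yes c≡b = ⊥-elim (c≢b c≡b)
... | no _    | no _    = refl

data SwapView (a b c : Atom) : Set where
  is-left  : c ≡ a → SwapView a b c
  is-right : c ≢ a → c ≡ b → SwapView a b c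
  is-other : c ≢ a → c ≢ b → SwapView a b c

swapView : ∀ a b c → SwapView a b c
swapView a b c with c ≟A a | c ≟A b
... | yes p | _     = is-left p
... | no p  | yes q = is-right p q
... | no p  | no q  = is-other p q

swapA-involutive : ∀ a b c → swapA a b (swapA a b c) ≡ c
swapA-involutive a b c with swapView a b c
... | is-left refl =
  trans (cong (swapA a b) (swapA-left a b)) (swapA-right a b)
... | is-right _ refl =
  trans (cong (swapA a b) (swapA-right a b)) (swapA-left a b)
... | is-other p q =
  trans (cong (swapA a b) (swapA-other a b c p q)) (swapA-other a b c p q)

swapA-level : ∀ a b c → level a ≡ level b → level (swapA a b c) ≡ level c
swapA-level a b c l with swapView a b c
... | is-left refl    = trans (cong level (swapA-left a b)) (sym l)
... | is-right _ refl = trans (cong level (swapA-right a b)) l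
... | is-other p q    = cong level (swapA-other a b c p q)

-- Swapping with c ∉ {v, d} in between:  (d p) v = (d c) ((c p) v).
-- This is what makes the choice of a fresh atom in [a]X irrelevant.
swapA-through : ∀ {d c p v} → v ≢ c → v ≢ d →
                swapA d p v ≡ swapA d c (swapA c p v)
swapA-through {d} {c} {p} {v} v≢c v≢d = by-cases (v ≟A p)
  where
  by-cases : Dec (v ≡ p) → swapA d p v ≡ swapA d c (swapA c p v)
  by-cases (yes refl) =
    trans (swapA-right d v)
          (trans (sym (swapA-right d c)) (cong (swapA d c) (sym (swapA-right c v))))
  by-cases (no v≢p) =
    trans (swapA-other d p v v≢d v≢p)
          (sym (trans (cong (swapA d c) (swapA-other c p v v≢c v≢p))
                      (swapA-other d c v v≢d v≢c)))

-- Swappings and their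
-- composites are renamings; working with arbitrary renamings gives the
-- induction hypotheses needed under binders.

record Renaming (f : Atom → Atom) : Set where
  field
    injective       : ∀ {u v} → f u ≡ f v → u ≡ v
    preserves-level : ∀ u → level (f u) ≡ level u
open Renaming

swap-renaming : ∀ {a b} → level a ≡ level b → Renaming (swapA a b)
swap-renaming {a} {b} l = record
  { injective       = λ {u} {v} e →
      trans (sym (swapA-involutive a b u))
            (trans (cong (swapA a b) e) (swapA-involutive a b v))
  ; preserves-level = λ u → swapA-level a b u l }

∘-renaming : ∀ {f g} → Renaming f → Renaming g → Renaming (f ∘ g)
∘-renaming rf rg = record
  { injective       = λ e → injective rg (injective rf e)
  ; preserves-level = λ u → trans (preserves-level rf _) (preserves-level rg u) }

id-renaming : Renaming id
id-renaming = record { injective = id ; preserves-level = λ _ → refl }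

swapA-conjugate : ∀ {π} → Renaming π → ∀ c a u →
                  swapA (π c) (π a) (π u) ≡ π (swapA c a u)
swapA-conjugate {π} rπ c a u with swapView c a u
... | is-left refl =
  trans (swapA-left (π c) (π a)) (cong π (sym (swapA-left c a)))
... | is-right _ refl =
  trans (swapA-right (π c) (π a)) (cong π (sym (swapA-right c a)))
... | is-other p q =
  trans (swapA-other (π c) (π a) (π u) (p ∘ injective rπ) (q ∘ injective rπ))
        (cong π (sym (swapA-other c a u p q)))

mutual
  rename : (Atom → Atom) → Tm → Tm
  rename f (atm a)   = atm (f a)
  rename f (and Xs)  = and (renameL f Xs)
  rename f (neg X)   = neg (rename f X)
  rename f (all a X) = all (f a) (rename f X)
  rename f (elt x a) = elt (rename f x) (f a)
  rename f (st a X)  = st (f a) (rename f X)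

  renameL : (Atom → Atom) → List Tm → List Tm
  renameL f []       = []
  renameL f (X ∷ Xs) = rename f X ∷ renameL f Xs

mutual
  swap-is-rename : ∀ a b t → swap a b t ≡ rename (swapA a b) t
  swap-is-rename a b (atm c)   = refl
  swap-is-rename a b (and Xs)  = cong and (swapL-is-renameL a b Xs)
  swap-is-rename a b (neg X)   = cong neg (swap-is-rename a b X)
  swap-is-rename a b (all c X) = cong (all _) (swap-is-rename a b X)
  swap-is-rename a b (elt x c) = cong (λ t → elt t _) (swap-is-rename a b x)
  swap-is-rename a b (st c X)  = cong (st _) (swap-is-rename a b X)

  swapL-is-renameL : ∀ a b Xs → swapL a b Xs ≡ renameL (swapA a b) Xs
  swapL-is-renameL a b []       = refl
  swapL-is-renameL a b (X ∷ Xs) =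
    cong₂ _∷_ (swap-is-rename a b X) (swapL-is-renameL a b Xs)

mutual
  rename-ext : ∀ {f g} → (∀ e → f e ≡ g e) → ∀ t → rename f t ≡ rename g t
  rename-ext h (atm a)   = cong atm (h a)
  rename-ext h (and Xs)  = cong and (renameL-ext h Xs)
  rename-ext h (neg X)   = cong neg (rename-ext h X)
  rename-ext h (all a X) = cong₂ all (h a) (rename-ext h X)
  rename-ext h (elt x a) = cong₂ elt (rename-ext h x) (h a)
  rename-ext h (st a X)  = cong₂ st (h a) (rename-ext h X)

  renameL-ext : ∀ {f g} → (∀ e → f e ≡ g e) → ∀ Xs → renameL f Xs ≡ renameL g Xs
  renameL-ext h []       = refl
  renameL-ext h (X ∷ Xs) = cong₂ _∷_ (rename-ext h X) (renameL-ext h Xs)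

mutual
  rename-∘ : ∀ f g t → rename f (rename g t) ≡ rename (f ∘ g) t
  rename-∘ f g (atm a)   = refl
  rename-∘ f g (and Xs)  = cong and (renameL-∘ f g Xs)
  rename-∘ f g (neg X)   = cong neg (rename-∘ f g X)
  rename-∘ f g (all a X) = cong (all _) (rename-∘ f g X)
  rename-∘ f g (elt x a) = cong (λ t → elt t _) (rename-∘ f g x)
  rename-∘ f g (st a X)  = cong (st _) (rename-∘ f g X)

  renameL-∘ : ∀ f g Xs → renameL f (renameL g Xs) ≡ renameL (f ∘ g) Xs
  renameL-∘ f g []       = refl
  renameL-∘ f g (X ∷ Xs) = cong₂ _∷_ (rename-∘ f g X) (renameL-∘ f g Xs)

mutual
  rename-id : ∀ t → rename id t ≡ t
  rename-id (atm a)   = refl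
  rename-id (and Xs)  = cong and (renameL-id Xs)
  rename-id (neg X)   = cong neg (rename-id X)
  rename-id (all a X) = cong (all _) (rename-id X)
  rename-id (elt x a) = cong (λ t → elt t _) (rename-id x)
  rename-id (st a X)  = cong (st _) (rename-id X)

  renameL-id : ∀ Xs → renameL id Xs ≡ Xs
  renameL-id []       = refl
  renameL-id (X ∷ Xs) = cong₂ _∷_ (rename-id X) (renameL-id Xs)

swap-rename : ∀ a b f X → swap a b (rename f X) ≡ rename (swapA a b ∘ f) X
swap-rename a b f X = trans (swap-is-rename a b (rename f X)) (rename-∘ (swapA a b) f X)

rename-swap : ∀ f a b X → rename f (swap a b X) ≡ rename (f ∘ swapA a b) X
rename-swap f a b X = trans (cong (rename f) (swap-is-rename a b X)) (rename-∘ f (swapA a b) X)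

swap-swap : ∀ d b A → rename (swapA d b) (swap d b A) ≡ A
swap-swap d b A =
  trans (rename-swap (swapA d b) d b A)
        (trans (rename-ext (swapA-involutive d b) A) (rename-id A))

swap-conjugate : ∀ {π} → Renaming π → ∀ c a X →
                 swap (π c) (π a) (rename π X) ≡ rename π (swap c a X)
swap-conjugate {π} rπ c a X =
  trans (swap-rename (π c) (π a) π X)
  (trans (rename-ext (swapA-conjugate rπ c a) X)
  (trans (sym (rename-∘ π (swapA c a) X)) (cong (rename π) (sym (swap-is-rename c a X)))))

mutual
  fa-rename⁺ : ∀ {f} → Renaming f → ∀ {u} t → u ∈ fa t → f u ∈ fa (rename f t)
  fa-rename⁺ rf (atm a) (here refl) = here refl
  fa-rename⁺ rf (and Xs) p = faL-rename⁺ rf Xs p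
  fa-rename⁺ rf (neg X) p = fa-rename⁺ rf X p
  fa-rename⁺ rf (all a X) p with ∈-remove⁻ p
  ... | q , u≢a = ∈-remove⁺ (fa-rename⁺ rf X q) (u≢a ∘ injective rf)
  fa-rename⁺ rf (elt x a) (here refl) = here refl
  fa-rename⁺ rf (elt x a) (there p) = there (fa-rename⁺ rf x p)
  fa-rename⁺ rf (st a X) p with ∈-remove⁻ p
  ... | q , u≢a = ∈-remove⁺ (fa-rename⁺ rf X q) (u≢a ∘ injective rf)

  faL-rename⁺ : ∀ {f} → Renaming f → ∀ {u} Xs → u ∈ faL Xs → f u ∈ faL (renameL f Xs)
  faL-rename⁺ rf (X ∷ Xs) p with ∈-++⁻ (fa X) p
  ... | inj₁ q = ∈-++⁺ˡ (fa-rename⁺ rf X q)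
  ... | inj₂ q = ∈-++⁺ʳ (fa (rename _ X)) (faL-rename⁺ rf Xs q)

mutual
  fa-rename⁻ : ∀ {f v} t → v ∈ fa (rename f t) → ∃ λ u → u ∈ fa t × v ≡ f u
  fa-rename⁻ (atm a) (here refl) = a , here refl , refl
  fa-rename⁻ (and Xs) p = faL-rename⁻ Xs p
  fa-rename⁻ (neg X) p = fa-rename⁻ X p
  fa-rename⁻ {f} (all a X) p with ∈-remove⁻ p
  ... | q , v≢fa with fa-rename⁻ X q
  ... | u , r , refl = u , ∈-remove⁺ r (v≢fa ∘ cong f) , refl
  fa-rename⁻ (elt x a) (here refl) = a , here refl , refl
  fa-rename⁻ (elt x a) (there p) with fa-rename⁻ x p
  ... | u , r , e = u , there r , e
  fa-rename⁻ {f} (st a X) p with ∈-remove⁻ p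
  ... | q , v≢fa with fa-rename⁻ X q
  ... | u , r , refl = u , ∈-remove⁺ r (v≢fa ∘ cong f) , refl

  faL-rename⁻ : ∀ {f v} Xs → v ∈ faL (renameL f Xs) → ∃ λ u → u ∈ faL Xs × v ≡ f u
  faL-rename⁻ {f} (X ∷ Xs) p with ∈-++⁻ (fa (rename f X)) p
  ... | inj₁ q with fa-rename⁻ X q
  ...   | u , r , e = u , ∈-++⁺ˡ r , e
  faL-rename⁻ {f} (X ∷ Xs) p | inj₂ q with faL-rename⁻ Xs q
  ...   | u , r , e = u , ∈-++⁺ʳ (fa X) r , e

#-rename : ∀ {f c} → Renaming f → ∀ X → c # X → f c # rename f X
#-rename rf X c#X p with fa-rename⁻ X p
... | u , r , e with injective rf e
... | refl = c#X r

AbsEq : Atom → Tm → Atom → Tm → Set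
AbsEq a X b Y = Σ Atom λ c → level a ≡ level b × level c ≡ level a ×
                c # X × c # Y × swap c a X ≈ swap c b Y

st-≈ : ∀ {a X b Y} → AbsEq a X b Y → st a X ≈ st b Y
st-≈ (c , la , lc , c#X , c#Y , s) = st≈ c la lc c#X c#Y s

all-≈ : ∀ {a X b Y} → AbsEq a X b Y → all a X ≈ all b Y
all-≈ (c , la , lc , c#X , c#Y , s) = all≈ c la lc c#X c#Y s

and-≈ : ∀ {Xs Ys} → Pointwise _≈_ Xs Ys → and Xs ≈ and Ys
and-≈ ps = and≈ (covers-left ps) (covers-right ps)
  where
  covers-left : ∀ {As Bs} → Pointwise _≈_ As Bs → All (λ A → Any (A ≈_) Bs) As
  covers-left []       = []
  covers-left (r ∷ rs) = here r ∷ All.map there (covers-left rs)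
  covers-right : ∀ {As Bs} → Pointwise _≈_ As Bs → All (λ B → Any (_≈ B) As) Bs
  covers-right []       = []
  covers-right (r ∷ rs) = here r ∷ All.map there (covers-right rs)

-- The binder case: after renaming [e]X by f and by g, choose w fresh for
-- both results; (w f(e))∘f and (w g(e))∘g agree on all of fa X.
abs-rename-support :
  ∀ e X {f g} → Renaming f → Renaming g →
  (∀ u → u ∈ remove e (fa X) → f u ≡ g u) →
  (∀ {f' g'} → Renaming f' → Renaming g' →
     (∀ u → u ∈ fa X → f' u ≡ g' u) → rename f' X ≈ rename g' X) →
  AbsEq (f e) (rename f X) (g e) (rename g X)
abs-rename-support e X {f} {g} rf rg agree ih =
  w , level-fg , refl , w#fX , w#gX ,
  subst₂ _≈_ (sym (swap-rename w (f e) f X)) (sym (swap-rename w (g e) g X))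
    (ih (∘-renaming (swap-renaming refl) rf) (∘-renaming (swap-renaming level-fg) rg) agree′)
  where
  level-fg : level (f e) ≡ level (g e)
  level-fg = trans (preserves-level rf e) (sym (preserves-level rg e))
  L = fa (rename f X) ++ fa (rename g X)
  w = fresh (level (f e)) L
  w#fX : w # rename f X
  w#fX p = fresh-∉ _ L (∈-++⁺ˡ p)
  w#gX : w # rename g X
  w#gX p = fresh-∉ _ L (∈-++⁺ʳ (fa (rename f X)) p)
  w-avoids : ∀ {h} → Renaming h → w # rename h X → ∀ {u} → u ∈ fa X → h u ≢ w
  w-avoids {h} rh w# p q = w# (subst (_∈ fa (rename h X)) q (fa-rename⁺ rh X p))
  agree′ : ∀ u → u ∈ fa X → swapA w (f e) (f u) ≡ swapA w (g e) (g u)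
  agree′ u p with u ≟A e
  ... | yes refl = trans (swapA-right w (f u)) (sym (swapA-right w (g u)))
  ... | no u≢e =
    trans (swapA-other w (f e) (f u) (w-avoids rf w#fX p) (u≢e ∘ injective rf))
    (trans (agree u (∈-remove⁺ p u≢e))
           (sym (swapA-other w (g e) (g u) (w-avoids rg w#gX p) (u≢e ∘ injective rg))))

mutual
  rename-support : ∀ X {f g} → Renaming f → Renaming g →
                   (∀ u → u ∈ fa X → f u ≡ g u) → rename f X ≈ rename g X
  rename-support (atm a) {f} rf rg agree =
    subst (λ b → atm (f a) ≈ atm b) (agree a (here refl)) atm≈
  rename-support (and Xs) rf rg agree = and-≈ (renameL-support Xs rf rg agree)
  rename-support (neg X) rf rg agree = neg≈ (rename-support X rf rg agree)
  rename-support (all a X) rf rg agree =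
    all-≈ (abs-rename-support a X rf rg agree (rename-support X))
  rename-support (elt x a) {f} {g} rf rg agree =
    subst (λ b → elt (rename f x) (f a) ≈ elt (rename g x) b) (agree a (here refl))
      (elt≈ (rename-support x rf rg (λ u p → agree u (there p))))
  rename-support (st a X) rf rg agree =
    st-≈ (abs-rename-support a X rf rg agree (rename-support X))

  renameL-support : ∀ Xs {f g} → Renaming f → Renaming g →
                    (∀ u → u ∈ faL Xs → f u ≡ g u) →
                    Pointwise _≈_ (renameL f Xs) (renameL g Xs)
  renameL-support [] rf rg agree = []
  renameL-support (X ∷ Xs) rf rg agree =
    rename-support X rf rg (λ u p → agree u (∈-++⁺ˡ p)) ∷
    renameL-support Xs rf rg (λ u p → agree u (∈-++⁺ʳ (fa X) p))

≈-refl : ∀ X → X ≈ X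
≈-refl X = subst₂ _≈_ (rename-id X) (rename-id X)
  (rename-support X id-renaming id-renaming (λ _ _ → refl))

abs-rename : ∀ {π} → Renaming π → ∀ {a b X Y} c → level a ≡ level b → level c ≡ level a →
             c # X → c # Y → rename π (swap c a X) ≈ rename π (swap c b Y) →
             AbsEq (π a) (rename π X) (π b) (rename π Y)
abs-rename {π} rπ {a} {b} {X} {Y} c la lc c#X c#Y s =
  π c ,
  trans (preserves-level rπ a) (trans la (sym (preserves-level rπ b))) ,
  trans (preserves-level rπ c) (trans lc (sym (preserves-level rπ a))) ,
  #-rename rπ X c#X , #-rename rπ Y c#Y ,
  subst₂ _≈_ (sym (swap-conjugate rπ c a X)) (sym (swap-conjugate rπ c b Y)) s

mutual
  rename-≈ : ∀ {π} → Renaming π → ∀ {X Y} → X ≈ Y → rename π X ≈ rename π Y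
  rename-≈ rπ atm≈ = atm≈
  rename-≈ rπ (and≈ l r) = and≈ (rename-covers rπ l) (rename-covered rπ r)
  rename-≈ rπ (neg≈ p) = neg≈ (rename-≈ rπ p)
  rename-≈ rπ (all≈ c la lc c#X c#Y s) = all-≈ (abs-rename rπ c la lc c#X c#Y (rename-≈ rπ s))
  rename-≈ rπ (elt≈ p) = elt≈ (rename-≈ rπ p)
  rename-≈ rπ (st≈ c la lc c#X c#Y s) = st-≈ (abs-rename rπ c la lc c#X c#Y (rename-≈ rπ s))

  rename-covers : ∀ {π} → Renaming π → ∀ {Xs Ys} → All (λ X → Any (X ≈_) Ys) Xs →
                  All (λ X → Any (X ≈_) (renameL π Ys)) (renameL π Xs)
  rename-covers rπ [] = []
  rename-covers rπ (a ∷ as) = rename-any rπ a ∷ rename-covers rπ as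

  rename-any : ∀ {π} → Renaming π → ∀ {X Ys} → Any (X ≈_) Ys →
               Any (rename π X ≈_) (renameL π Ys)
  rename-any rπ (here p)  = here (rename-≈ rπ p)
  rename-any rπ (there q) = there (rename-any rπ q)

  rename-covered : ∀ {π} → Renaming π → ∀ {Xs Ys} → All (λ Y → Any (_≈ Y) Xs) Ys →
                   All (λ Y → Any (_≈ Y) (renameL π Xs)) (renameL π Ys)
  rename-covered rπ [] = []
  rename-covered rπ (a ∷ as) = rename-any′ rπ a ∷ rename-covered rπ as

  rename-any′ : ∀ {π} → Renaming π → ∀ {Y Xs} → Any (_≈ Y) Xs →
                Any (_≈ rename π Y) (renameL π Xs)
  rename-any′ rπ (here p)  = here (rename-≈ rπ p)
  rename-any′ rπ (there q) = there (rename-any′ rπ q)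

mutual
  ≈-sym : ∀ {X Y} → X ≈ Y → Y ≈ X
  ≈-sym atm≈ = atm≈
  ≈-sym (and≈ l r) = and≈ (flip-covered r) (flip-covers l)
  ≈-sym (neg≈ p) = neg≈ (≈-sym p)
  ≈-sym (all≈ c la lc c#X c#Y s) = all≈ c (sym la) (trans lc la) c#Y c#X (≈-sym s)
  ≈-sym (elt≈ p) = elt≈ (≈-sym p)
  ≈-sym (st≈ c la lc c#X c#Y s) = st≈ c (sym la) (trans lc la) c#Y c#X (≈-sym s)

  flip-covered : ∀ {Xs Ys} → All (λ Y → Any (_≈ Y) Xs) Ys → All (λ Y → Any (Y ≈_) Xs) Ys
  flip-covered [] = []
  flip-covered (a ∷ as) = flip-any a ∷ flip-covered as

  flip-any : ∀ {Y Xs} → Any (_≈ Y) Xs → Any (Y ≈_) Xs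
  flip-any (here p)  = here (≈-sym p)
  flip-any (there q) = there (flip-any q)

  flip-covers : ∀ {Xs Ys} → All (λ X → Any (X ≈_) Ys) Xs → All (λ X → Any (_≈ X) Ys) Xs
  flip-covers [] = []
  flip-covers (a ∷ as) = flip-any′ a ∷ flip-covers as

  flip-any′ : ∀ {X Ys} → Any (X ≈_) Ys → Any (_≈ X) Ys
  flip-any′ (here p)  = here (≈-sym p)
  flip-any′ (there q) = there (flip-any′ q)

-- Binder case: a free atom e of [b]Y is free in (c b)·Y (as e ≠ c, b),
-- hence in (c a)·X, hence free in [a]X.
fa-abs : ∀ {a b X Y e} c → level c ≡ level b → c # X → c # Y →
         (e ∈ fa (swap c b Y) → e ∈ fa (swap c a X)) →
         e ∈ remove b (fa Y) → e ∈ remove a (fa X)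
fa-abs {a} {b} {X} {Y} {e} c lc c#X c#Y ih p with ∈-remove⁻ p
... | e∈Y , e≢b = back (fa-rename⁻ X (subst (λ t → e ∈ fa t) (swap-is-rename c a X) (ih e∈cbY)))
  where
  e≢c : e ≢ c
  e≢c refl = c#Y e∈Y
  e∈cbY : e ∈ fa (swap c b Y)
  e∈cbY = subst (λ t → e ∈ fa t) (sym (swap-is-rename c b Y))
            (subst (λ v → v ∈ fa (rename (swapA c b) Y)) (swapA-other c b e e≢c e≢b)
               (fa-rename⁺ (swap-renaming lc) Y e∈Y))
  back : (∃ λ u → u ∈ fa X × e ≡ swapA c a u) → e ∈ remove a (fa X)
  back (u , u∈X , eq) with swapView c a u
  ... | is-left refl    = ⊥-elim (c#X u∈X)
  ... | is-right _ refl = ⊥-elim (e≢c (trans eq (swapA-right c u)))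
  ... | is-other u≢c u≢a =
    ∈-remove⁺ (subst (_∈ fa X) (sym e≡u) u∈X) (λ e≡a → u≢a (trans (sym e≡u) e≡a))
    where e≡u = trans eq (swapA-other c a u u≢c u≢a)

mutual
  fa-≈ : ∀ {X Y e} → X ≈ Y → e ∈ fa Y → e ∈ fa X
  fa-≈ atm≈ p = p
  fa-≈ (and≈ l r) p = fa-covered r p
  fa-≈ (neg≈ q) p = fa-≈ q p
  fa-≈ (all≈ {a} {b} {X} {Y} c la lc c#X c#Y s) p = fa-abs {a} {b} {X} {Y} c (trans lc la) c#X c#Y (fa-≈ s) p
  fa-≈ (elt≈ q) (here refl) = here refl
  fa-≈ (elt≈ q) (there p) = there (fa-≈ q p)
  fa-≈ (st≈ {a} {b} {X} {Y} c la lc c#X c#Y s) p = fa-abs {a} {b} {X} {Y} c (trans lc la) c#X c#Y (fa-≈ s) p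

  fa-covered : ∀ {Xs Ys e} → All (λ Y → Any (_≈ Y) Xs) Ys → e ∈ faL Ys → e ∈ faL Xs
  fa-covered {Ys = Y ∷ Ys} (a ∷ as) p with ∈-++⁻ (fa Y) p
  ... | inj₁ q = fa-any a q
  ... | inj₂ q = fa-covered as q

  fa-any : ∀ {Xs Y e} → Any (_≈ Y) Xs → e ∈ fa Y → e ∈ faL Xs
  fa-any (here r) q = ∈-++⁺ˡ (fa-≈ r q)
  fa-any {X ∷ Xs} (there a) q = ∈-++⁺ʳ (fa X) (fa-any a q)

#-≈ : ∀ {X Y e} → X ≈ Y → e # X → e # Y
#-≈ X≈Y e#X p = e#X (fa-≈ X≈Y p)

-- Transitivity.  Proved by induction on X for the statement
-- "rename f X ≈ Y → Y ≈ W → rename f X ≈ W" for every renaming f, since in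
-- the binder case the bodies are compared after swapping.

TransFrom : Tm → Set
TransFrom X = ∀ {f} Y W → Renaming f → rename f X ≈ Y → Y ≈ W → rename f X ≈ W

swap-via : ∀ {p Z} c d → level c ≡ level p → level d ≡ level p → c # Z → d # Z →
           swap d p Z ≈ rename (swapA d c) (swap c p Z)
swap-via {p} {Z} c d lc ld c#Z d#Z =
  subst₂ _≈_ (sym (swap-is-rename d p Z)) (sym (rename-swap (swapA d c) c p Z))
    (rename-support Z (swap-renaming ld)
       (∘-renaming (swap-renaming (trans ld (sym lc))) (swap-renaming lc))
       (λ u u∈Z → swapA-through (avoid c#Z u∈Z) (avoid d#Z u∈Z)))
  where
  avoid : ∀ {v u} → v # Z → u ∈ fa Z → u ≢ v
  avoid v#Z u∈Z refl = v#Z u∈Z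

-- Binder case: compose [f a](f·X) = [b]Y = [e]W through an atom d fresh
-- for all three bodies, using the induction hypothesis at (d f(a))∘f.
abs-trans : ∀ a X {f} → Renaming f → TransFrom X → ∀ {b Y e W} →
            AbsEq (f a) (rename f X) b Y → AbsEq b Y e W → AbsEq (f a) (rename f X) e W
abs-trans a X {f} rf ih {b} {Y} {e} {W}
          (c , l₁ , lc , c#fX , c#Y , s₁) (c′ , l₂ , lc′ , c′#Y , c′#W , s₂) =
  d , trans l₁ l₂ , refl , d#fX , d#W ,
  subst (_≈ swap d e W) (sym (swap-rename d (f a) f X))
    (step (step (step (step (step first
      (rename-≈ (swap-renaming (sym lc)) s₁))
      (≈-sym (swap-via c d (trans lc l₁) l₁ c#Y d#Y)))
      (swap-via c′ d lc′ l₁ c′#Y d#Y))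
      (rename-≈ (swap-renaming (trans l₁ (sym lc′))) s₂))
      (≈-sym (swap-via c′ d (trans lc′ l₂) (trans l₁ l₂) c′#W d#W)))
  where
  fX = rename f X
  L = fa fX ++ fa Y ++ fa W
  d = fresh (level (f a)) L
  d#fX : d # fX
  d#fX p = fresh-∉ _ L (∈-++⁺ˡ p)
  d#Y : d # Y
  d#Y p = fresh-∉ _ L (∈-++⁺ʳ (fa fX) (∈-++⁺ˡ p))
  d#W : d # W
  d#W p = fresh-∉ _ L (∈-++⁺ʳ (fa fX) (∈-++⁺ʳ (fa Y) p))
  step : ∀ {U V} → rename (swapA d (f a) ∘ f) X ≈ U → U ≈ V → rename (swapA d (f a) ∘ f) X ≈ V
  step = ih _ _ (∘-renaming (swap-renaming refl) rf)
  first : rename (swapA d (f a) ∘ f) X ≈ rename (swapA d c) (swap c (f a) fX)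
  first = subst (_≈ rename (swapA d c) (swap c (f a) fX)) (swap-rename d (f a) f X)
                (swap-via c d lc refl c#fX d#fX)

module _ {f} (rf : Renaming f) where

  trans-any : ∀ {X Ys Ws} → TransFrom X → Any (rename f X ≈_) Ys →
              All (λ Y → Any (Y ≈_) Ws) Ys → Any (rename f X ≈_) Ws
  trans-any t (here p)  (q ∷ _)  = Any.map (t _ _ rf p) q
  trans-any t (there a) (_ ∷ qs) = trans-any t a qs

  trans-covers : ∀ {Xs Ys Ws} → All TransFrom Xs →
                 All (λ X → Any (X ≈_) Ys) (renameL f Xs) → All (λ Y → Any (Y ≈_) Ws) Ys →
                 All (λ X → Any (X ≈_) Ws) (renameL f Xs)
  trans-covers {[]}     []       []       _  = []
  trans-covers {X ∷ Xs} (t ∷ ts) (a ∷ as) qs = trans-any t a qs ∷ trans-covers ts as qs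

  trans-back : ∀ {Xs Y W} → All TransFrom Xs → Any (_≈ Y) (renameL f Xs) → Y ≈ W →
               Any (_≈ W) (renameL f Xs)
  trans-back {X ∷ Xs} (t ∷ ts) (here p)  q = here (t _ _ rf p q)
  trans-back {X ∷ Xs} (t ∷ ts) (there a) q = there (trans-back ts a q)

  trans-any′ : ∀ {Xs Ys W} → All TransFrom Xs → Any (_≈ W) Ys →
               All (λ Y → Any (_≈ Y) (renameL f Xs)) Ys → Any (_≈ W) (renameL f Xs)
  trans-any′ ts (here p)  (q ∷ _)  = trans-back ts q p
  trans-any′ ts (there a) (_ ∷ qs) = trans-any′ ts a qs

  trans-covered : ∀ {Xs Ys Ws} → All TransFrom Xs → All (λ W → Any (_≈ W) Ys) Ws →
                  All (λ Y → Any (_≈ Y) (renameL f Xs)) Ys → All (λ W → Any (_≈ W) (renameL f Xs)) Ws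
  trans-covered ts []       _  = []
  trans-covered ts (a ∷ as) qs = trans-any′ ts a qs ∷ trans-covered ts as qs

mutual
  trans-from : ∀ X → TransFrom X
  trans-from (atm a) _ _ rf atm≈ atm≈ = atm≈
  trans-from (and Xs) _ _ rf (and≈ l₁ r₁) (and≈ l₂ r₂) =
    and≈ (trans-covers rf (trans-fromL Xs) l₁ l₂) (trans-covered rf (trans-fromL Xs) r₂ r₁)
  trans-from (neg X) _ _ rf (neg≈ p) (neg≈ q) = neg≈ (trans-from X _ _ rf p q)
  trans-from (all a X) _ _ rf (all≈ c la lc c#X c#Y s) (all≈ c′ la′ lc′ c′#Y c′#W s′) =
    all-≈ (abs-trans a X rf (trans-from X) (c , la , lc , c#X , c#Y , s)
                                           (c′ , la′ , lc′ , c′#Y , c′#W , s′))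
  trans-from (elt x a) _ _ rf (elt≈ p) (elt≈ q) = elt≈ (trans-from x _ _ rf p q)
  trans-from (st a X) _ _ rf (st≈ c la lc c#X c#Y s) (st≈ c′ la′ lc′ c′#Y c′#W s′) =
    st-≈ (abs-trans a X rf (trans-from X) (c , la , lc , c#X , c#Y , s)
                                          (c′ , la′ , lc′ , c′#Y , c′#W , s′))

  trans-fromL : ∀ Xs → All TransFrom Xs
  trans-fromL []       = []
  trans-fromL (X ∷ Xs) = (λ {f} → trans-from X {f}) ∷ trans-fromL Xs

≈-trans : ∀ {X Y W} → X ≈ Y → Y ≈ W → X ≈ W
≈-trans {X} {Y} {W} p q =
  subst (_≈ W) (rename-id X) (trans-from X Y W id-renaming (subst (_≈ Y) (sym (rename-id X)) p) q)

abs-cong : ∀ b {X Y} → X ≈ Y → AbsEq b X b Y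
abs-cong b {X} {Y} X≈Y =
  d , refl , refl , (λ p → fresh-∉ _ L (∈-++⁺ˡ p)) , (λ p → fresh-∉ _ L (∈-++⁺ʳ (fa X) p)) ,
  subst₂ _≈_ (sym (swap-is-rename d b X)) (sym (swap-is-rename d b Y))
    (rename-≈ (swap-renaming refl) X≈Y)
  where
  L = fa X ++ fa Y
  d = fresh (level b) L

st-cong : ∀ b {X Y} → X ≈ Y → st b X ≈ st b Y
st-cong b = st-≈ ∘ abs-cong b

all-cong : ∀ b {X Y} → X ≈ Y → all b X ≈ all b Y
all-cong b = all-≈ ∘ abs-cong b

st-injective : ∀ {b X Y} → st b X ≈ st b Y → X ≈ Y
st-injective {b} {X} {Y} (st≈ d _ ld _ _ s) =
  subst₂ _≈_ (swap-swap d b X) (swap-swap d b Y) (rename-≈ (swap-renaming ld) s)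

abs-rename-bound : ∀ p Z q → q # Z → level q ≡ level p → AbsEq p Z q (swap q p Z)
abs-rename-bound p Z q q#Z lq =
  d , sym lq , refl , d#Z , d#qpZ ,
  subst (swap d p Z ≈_) (sym (swap-is-rename d q (swap q p Z))) (swap-via q d lq refl q#Z d#Z)
  where
  L = fa Z ++ fa (swap q p Z)
  d = fresh (level p) L
  d#Z : d # Z
  d#Z r = fresh-∉ _ L (∈-++⁺ˡ r)
  d#qpZ : d # swap q p Z
  d#qpZ r = fresh-∉ _ L (∈-++⁺ʳ (fa Z) r)

swap-fresh : ∀ {b c} y → level b ≡ level c → b # y → c # y → swap b c y ≈ y
swap-fresh {b} {c} y l b#y c#y =
  subst₂ _≈_ (sym (swap-is-rename b c y)) (rename-id y)
    (rename-support y (swap-renaming l) id-renaming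
       (λ u u∈y → swapA-other b c u (λ { refl → b#y u∈y }) (λ { refl → c#y u∈y })))

-- To push Z[a ↦ x] under a binder [e]B (with a # [e]B) the clauses of
-- the sigma-action demand a bound atom distinct from a and fresh for x;
-- e' is such an atom and [e]B = [e']((e' e)·B) with a # (e' e)·B.
record FreshBinder (a : Atom) (x : Tm) (e : Atom) (B : Tm) : Set where
  field
    e′        : Atom
    e′-level  : level e′ ≡ level e
    e′≢a      : e′ ≢ a
    e′#x      : e′ # x
    a#body    : a # swap e′ e B
    α-renamed : AbsEq e B e′ (swap e′ e B)

fresh-binder : ∀ a x e B → a ∉ remove e (fa B) → FreshBinder a x e B
fresh-binder a x e B a#eB = record
  { e′ = e′ ; e′-level = refl
  ; e′≢a = λ q → fresh-∉ _ L (here q)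
  ; e′#x = λ q → fresh-∉ _ L (there (∈-++⁺ˡ q))
  ; a#body = a#body
  ; α-renamed = abs-rename-bound e B e′ e′#B refl }
  where
  L = a ∷ fa x ++ fa B
  e′ = fresh (level e) L
  e′#B : e′ # B
  e′#B q = fresh-∉ _ L (there (∈-++⁺ʳ (fa x) q))
  a#body : a # swap e′ e B
  a#body q with fa-rename⁻ B (subst (λ t → a ∈ fa t) (swap-is-rename e′ e B) q)
  ... | v , v∈B , a≡ with swapView e′ e v
  ...   | is-left refl    = e′#B v∈B
  ...   | is-right _ refl = fresh-∉ _ L (here (sym (trans a≡ (swapA-right e′ v))))
  ...   | is-other v≢e′ v≢e =
    a#eB (∈-remove⁺ (subst (_∈ fa B) (sym a≡v) v∈B) (λ a≡e → v≢e (trans (sym a≡v) a≡e)))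
    where a≡v = trans a≡ (swapA-other e′ e v v≢e′ v≢e)

-- Z[a ↦ x] = Z for a # Z, stated for all renamings Z = f·w so that the
-- induction hypothesis applies to the α-renamed body of a binder.
mutual
  sub-fresh-renamed : ∀ w {f} → Renaming f → ∀ {a x} → a # rename f w →
                      Sub a x (rename f w) (rename f w)
  sub-fresh-renamed (atm b) rf a# = sub-atm-other (λ e → a# (here (sym e)))
  sub-fresh-renamed (and Xs) rf a# = sub-and (subL-fresh-renamed Xs rf a#)
  sub-fresh-renamed (neg X) rf a# = sub-neg (sub-fresh-renamed X rf a#)
  sub-fresh-renamed (elt y b) rf a# =
    sub-elt (λ e → a# (here (sym e))) (sub-fresh-renamed y rf (a# ∘ there))
  sub-fresh-renamed (all e X) {f} rf {a} {x} a# =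
    sub-≈ (≈-refl x) (all-≈ α-renamed) (≈-sym (all-≈ α-renamed))
          (sub-all e′≢a e′#x (sub-fresh-body X e rf e′-level a#body))
    where open FreshBinder (fresh-binder a x (f e) (rename f X) a#)
  sub-fresh-renamed (st e X) {f} rf {a} {x} a# =
    sub-≈ (≈-refl x) (st-≈ α-renamed) (≈-sym (st-≈ α-renamed))
          (sub-st e′≢a e′#x (sub-fresh-body X e rf e′-level a#body))
    where open FreshBinder (fresh-binder a x (f e) (rename f X) a#)

  -- The body (e' f(e))·(f·X) is the renaming of X by (e' f(e)) ∘ f.
  sub-fresh-body : ∀ X e {f} → Renaming f → ∀ {a x e′} → level e′ ≡ level (f e) →
                   a # swap e′ (f e) (rename f X) →
                   Sub a x (swap e′ (f e) (rename f X)) (swap e′ (f e) (rename f X))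
  sub-fresh-body X e {f} rf {a} {x} {e′} l a#body =
    subst₂ (Sub a x) (sym eq) (sym eq)
      (sub-fresh-renamed X (∘-renaming (swap-renaming l) rf) (subst (a #_) eq a#body))
    where eq = swap-rename e′ (f e) f X

  subL-fresh-renamed : ∀ Xs {f} → Renaming f → ∀ {a x} → a ∉ faL (renameL f Xs) →
                       Pointwise (Sub a x) (renameL f Xs) (renameL f Xs)
  subL-fresh-renamed [] rf a# = []
  subL-fresh-renamed (X ∷ Xs) {f} rf a# =
    sub-fresh-renamed X rf (a# ∘ ∈-++⁺ˡ) ∷
    subL-fresh-renamed Xs rf (a# ∘ ∈-++⁺ʳ (fa (rename f X)))

sub-fresh : ∀ {a x} w → a # w → Sub a x w w
sub-fresh {a} {x} w a#w =
  subst₂ (Sub a x) (rename-id w) (rename-id w)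
    (sub-fresh-renamed w id-renaming (subst (a #_) (sym (rename-id w)) a#w))

mutual
  sub-fresh-≈ : ∀ {a x w w′} → Sub a x w w′ → a # w → w′ ≈ w
  sub-fresh-≈ (sub-≈ _ w≈ r≈ S) a#w =
    ≈-trans (≈-sym r≈) (≈-trans (sub-fresh-≈ S (#-≈ w≈ a#w)) (≈-sym w≈))
  sub-fresh-≈ (sub-and Ss) a#w = and-≈ (subL-fresh-≈ Ss a#w)
  sub-fresh-≈ (sub-neg S) a#w = neg≈ (sub-fresh-≈ S a#w)
  sub-fresh-≈ (sub-all b≢a _ S) a#w =
    all-cong _ (sub-fresh-≈ S (λ p → a#w (∈-remove⁺ p (b≢a ∘ sym))))
  sub-fresh-≈ (sub-elt-atm _) a#w = ⊥-elim (a#w (here refl))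
  sub-fresh-≈ (sub-elt-st _ _ _ _) a#w = ⊥-elim (a#w (here refl))
  sub-fresh-≈ (sub-elt _ S) a#w = elt≈ (sub-fresh-≈ S (a#w ∘ there))
  sub-fresh-≈ sub-atm-same a#w = ⊥-elim (a#w (here refl))
  sub-fresh-≈ (sub-atm-other _) a#w = atm≈
  sub-fresh-≈ (sub-st b≢a _ S) a#w =
    st-cong _ (sub-fresh-≈ S (λ p → a#w (∈-remove⁺ p (b≢a ∘ sym))))

  subL-fresh-≈ : ∀ {a x Xs Rs} → Pointwise (Sub a x) Xs Rs → a ∉ faL Xs → Pointwise _≈_ Rs Xs
  subL-fresh-≈ [] a# = []
  subL-fresh-≈ {Xs = X ∷ Xs} (S ∷ Ss) a# =
    sub-fresh-≈ S (a# ∘ ∈-++⁺ˡ) ∷ subL-fresh-≈ Ss (a# ∘ ∈-++⁺ʳ (fa X))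

≈-sub-fresh : ∀ {b x y w w′} → b # y → y ≈ w → Sub b x w w′ → y ≈ w′
≈-sub-fresh b#y y≈w S = ≈-trans y≈w (≈-sym (sub-fresh-≈ S (#-≈ y≈w b#y)))

data EltSub (a : Atom) (x w R : Tm) : Set where
  via-atm : ∀ {n w₀ w₀′} → x ≈ atm n → w ≈ w₀ → Sub a (atm n) w₀ w₀′ →
            elt w₀′ n ≈ R → EltSub a x w R
  via-st  : ∀ {a′ X′ w₀ w₀′} → x ≈ st a′ X′ → a′ ≢ a → a′ # w₀ → w ≈ w₀ →
            Sub a (st a′ X′) w₀ w₀′ → Sub a′ w₀′ X′ R → EltSub a x w R

sub-elt-inversion : ∀ {a x Z R w} → Sub a x Z R → elt w a ≈ Z → EltSub a x w R
sub-elt-inversion (sub-≈ x≈ Z≈ R≈ S) w≈ with sub-elt-inversion S (≈-trans w≈ Z≈)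
... | via-atm x≈n w≈w₀ S′ e≈R = via-atm (≈-trans x≈ x≈n) w≈w₀ S′ (≈-trans e≈R R≈)
... | via-st x≈st a′≢a a′# w≈w₀ S₁ S₂ =
  via-st (≈-trans x≈ x≈st) a′≢a a′# w≈w₀ S₁ (sub-≈ (≈-refl _) (≈-refl _) R≈ S₂)
sub-elt-inversion (sub-elt-atm S) (elt≈ w≈) = via-atm atm≈ w≈ S (≈-refl _)
sub-elt-inversion (sub-elt-st a′≢a a′# S₁ S₂) (elt≈ w≈) = via-st (≈-refl _) a′≢a a′# w≈ S₁ S₂
sub-elt-inversion (sub-elt a≢a _) (elt≈ _) = ⊥-elim (a≢a refl)

z-rename : ∀ {c b} y → level b ≡ level c → c # y → b # y → st c (elt y c) ≈ st b (elt y b)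
z-rename {c} {b} y lb c#y b#y with b ≟A c
... | yes refl = ≈-refl _
... | no b≢c =
  ≈-trans (st-≈ (abs-rename-bound c (elt y c) b b#elt lb))
          (st-cong b (subst (λ v → elt (swap b c y) v ≈ elt y b) (sym (swapA-right b c))
                             (elt≈ (swap-fresh y lb b#y c#y))))
  where
  b#elt : b # elt y c
  b#elt (here b≡c) = b≢c b≡c
  b#elt (there p)  = b#y p

z-mem⇒sub : ∀ {c x y R} → c # y → Mem x (st c (elt y c)) R →
            Σ Atom λ b → b # y × Sub b x (elt y b) R
z-mem⇒sub {c} {x} {y} {R} c#y (mem-st {b = b} {X = X} z≈ b#z _ S) =
  b , b#y , sub-≈ (≈-refl x) elt≈X (≈-refl R) S
  where
  level-bound : ∀ {a a′ A B} → st a A ≈ st a′ B → level a′ ≡ level a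
  level-bound (st≈ _ la _ _ _ _) = sym la
  b#y : b # y
  b#y p with b ≟A c
  ... | yes refl = c#y p
  ... | no b≢c   = b#z (∈-remove⁺ {c} {b} {c ∷ fa y} (there p) b≢c)
  elt≈X : elt y b ≈ X
  elt≈X = st-injective (≈-trans (≈-sym (z-rename y (level-bound z≈) c#y b#y)) z≈)

sub⇒z-mem : ∀ {c b x y R} → c # y → level b ≡ level c → b # x → b # y →
            Sub b x (elt y b) R → Mem x (st c (elt y c)) R
sub⇒z-mem {c} {b} {y = y} c#y lb b#x b#y S = mem-st (z-rename y lb c#y b#y) b#z b#x S
  where
  b#z : b # st c (elt y c)
  b#z p with ∈-remove⁻ {c} {b} {c ∷ fa y} p
  ... | here b≡c , b≢c = b≢c b≡c
  ... | there q , _    = b#y q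

-- elt(y,b)[b ↦ x] versus y ∈̃ x, for b # y: the two elt-clauses of the
-- sigma-action are the two clauses of membership, and y[b ↦ x] = y.

sub⇒mem : ∀ {b x y R} → b # y → Sub b x (elt y b) R → Mem y x R
sub⇒mem {b} {x} {y} b#y S with sub-elt-inversion S (≈-refl _)
... | via-atm atm≈ y≈w₀ S′ e≈R = mem-atm (≈-trans (elt≈ (≈-sub-fresh b#y y≈w₀ S′)) e≈R)
... | via-st {a′} {X′} x≈st _ a′#w₀ y≈w₀ S₁ S₂ =
  mem-st x≈st a′#x (#-≈ (≈-sym y≈w₀) a′#w₀)
    (sub-≈ (≈-sub-fresh b#y y≈w₀ S₁) (≈-refl X′) (≈-refl _) S₂)
  where
  a′#x : a′ # x
  a′#x p = ∉-remove a′ (fa X′) (fa-≈ (≈-sym x≈st) p)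

mem⇒sub : ∀ {x y R} → Mem y x R →
          Σ (List Atom) λ L → ∀ b → b ∉ L → b # y → Sub b x (elt y b) R
mem⇒sub {y = y} (mem-atm elt≈R) =
  [] , λ b _ b#y → sub-≈ (≈-refl _) (≈-refl _) elt≈R (sub-elt-atm (sub-fresh y b#y))
mem⇒sub {y = y} {R} (mem-st {b = b′} x≈st _ b′#y S) =
  b′ ∷ [] , λ b b∉ b#y →
    sub-≈ x≈st (≈-refl _) (≈-refl R)
      (sub-elt-st (λ b′≡b → b∉ (here (sym b′≡b))) b′#y (sub-fresh y b#y) S)

corollary4p27 : (k : ℤ) (c : Atom) (x y z : Tm) →
    level c ≡ k → IsSet k x → IsSet (k - 1ℤ) y → c # y →
    z ≡ st c (elt y c) → IsSet (k + 1ℤ) z →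
    (R : Tm) → Mem x z R ⇔ Mem y x R
corollary4p27 k c x y _ _ _ _ c#y refl _ R = mk⇔ to from
  where
  to : Mem x (st c (elt y c)) R → Mem y x R
  to m with z-mem⇒sub c#y m
  ... | b , b#y , S = sub⇒mem b#y S
  from : Mem y x R → Mem x (st c (elt y c)) R
  from m with mem⇒sub m
  ... | L , S = sub⇒z-mem c#y refl b#x b#y (S b (λ p → fresh-∉ _ L′ (∈-++⁺ˡ p)) b#y)
    where
    L′ = L ++ fa x ++ fa y
    b = fresh (level c) L′
    b#x : b # x
    b#x p = fresh-∉ _ L′ (∈-++⁺ʳ L (∈-++⁺ˡ p))
    b#y : b # y
    b#y p = fresh-∉ _ L′ (∈-++⁺ʳ L (∈-++⁺ʳ (fa x) p))
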